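{- Let $k\ge 1$ and let $A=a_1\ldots a_n$, $B=b_1\ldots b_n$ be sequences over an alphabet $\Sigma$. Define the matrix $M(i,j)$, $0\le i,j\le n$, by $M(i,j)=0$ whenever $i<k$ or $j<k$, and for $i,j\ge k$: $M(i,j)=M(i-k,j-k)+1$ if $A_{i-k+1\ldots i}=B_{j-k+1\ldots j}$, and $M(i,j)=\max(M(i,j-1),M(i-1,j))$ otherwise. For each row $i$ let $V(i)$ be the set of pairs $\langle M(i,j),j\rangle$ such that $M(i,j-1)+1=M(i,j)$. Then for every $i$, if $\langle h,j\rangle\in V(i)$, there is no $i'$ with $i\le i'\le i+k$ and no $j'<j+k$ such that $\langle h+1,j'\rangle\in V(i')$.
   Context: $X_{p\ldots q}$ denotes the substring $x_p x_{p+1}\ldots x_q$ of a sequence $X$. (For reference: $M(i,j)$ equals the length of the longest common subsequence in $k$-length substrings of the prefixes $A_{1\ldots i}$ and $B_{1\ldots j}$, i.e. the maximal number $\ell$ of pairs of equal length-$k$ substrings ending at positions $i_1<\dots<i_\ell\le i$ in $A$ and $j_1<\dots<j_\ell\le j$ in $B$ with $i_e+k\le i_{e+1}$ and $j_e+k\le j_{e+1}$.) -}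

module Defs where

open import Data.Nat using (ℕ; zero; suc; _+_; _∸_; _≤_; _<_; _⊔_; _<?_)
open import Data.Bool using (Bool; true; false; _∧_; if_then_else_)
open import Data.Product using (_×_)
open import Relation.Nullary using (yes; no)
open import Relation.Nullary.Decidable using (⌊_⌋)
open import Relation.Binary.Definitions using (DecidableEquality)
open import Relation.Binary.PropositionalEquality using (_≡_)

-- Sequences A = a_1 … a_n are given as functions ℕ → Σ, where a_p = A p
-- for 1 ≤ p ≤ n (values outside 1..n are never read by M(i,j) with i,j ≤ n).

module _ {Σ : Set} (_≟_ : DecidableEquality Σ) (A B : ℕ → Σ) where

  blockEq : ℕ → ℕ → ℕ → Bool
  blockEq zero    i j = true
  blockEq (suc t) i j = ⌊ A i ≟ B j ⌋ ∧ blockEq t (i ∸ 1) (j ∸ 1)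

  -- The recurrence for M, computed with a fuel argument s ≥ i + j
  -- (each recursive call decreases i + j by at least 1 since k ≥ 1).
  Mfuel : ℕ → ℕ → ℕ → ℕ → ℕ
  Mfuel k zero    i j = 0
  Mfuel k (suc s) i j with i <? k | j <? k
  ... | yes _ | _     = 0
  ... | no _  | yes _ = 0
  ... | no _  | no _  =
    if blockEq k i j
    then suc (Mfuel k s (i ∸ k) (j ∸ k))
    else (Mfuel k s i (j ∸ 1) ⊔ Mfuel k s (i ∸ 1) j)

  M : ℕ → ℕ → ℕ → ℕ
  M k i j = Mfuel k (i + j) i j

  InV : ℕ → ℕ → ℕ → ℕ → ℕ → Set
  InV n k i h j = i ≤ n × 1 ≤ j × j ≤ n × (M k i (j ∸ 1) + 1 ≡ M k i j) × h ≡ M k i j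

-- M(i,j) is monotone in both coordinates, and one diagonal step of size k
-- raises it by at most one: M(i,j) ≤ M(i-k,j-k) + 1.  If ⟨h,j⟩ ∈ V(i), then
-- h = M(i,j-1) + 1, while every (i',j') with i' ≤ i + k and j' < j + k has
-- (i'-k, j'-k) ≤ (i, j-1) coordinatewise, so M(i',j') ≤ M(i,j-1) + 1 = h < h + 1.

module Submission where

open import Defs
open import Data.Nat using (ℕ; zero; suc; _+_; _∸_; _≤_; _<_; _⊔_; _<?_; _≤′_; ≤′-refl; ≤′-step; z≤n; s≤s)
open import Data.Nat.Properties
open import Data.Bool using (Bool; true; false; if_then_else_)
open import Data.Product using (_×_; _,_; proj₁; proj₂; ∃-syntax)
open import Relation.Nullary using (¬_; yes; no; contradiction)
open import Relation.Binary.Definitions using (DecidableEquality)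
open import Relation.Binary.PropositionalEquality

∸-∸-comm : ∀ m n o → m ∸ n ∸ o ≡ m ∸ o ∸ n
∸-∸-comm m n o = begin
  m ∸ n ∸ o   ≡⟨ ∸-+-assoc m n o ⟩
  m ∸ (n + o) ≡⟨ cong (m ∸_) (+-comm n o) ⟩
  m ∸ (o + n) ≡⟨ ∸-+-assoc m o n ⟨
  m ∸ o ∸ n   ∎
  where open ≡-Reasoning

monotone-from-step : (f : ℕ → ℕ) → (∀ n → f n ≤ f (suc n)) → ∀ {m n} → m ≤ n → f m ≤ f n
monotone-from-step f step m≤n = go (≤⇒≤′ m≤n)
  where
  go : ∀ {m n} → m ≤′ n → f m ≤ f n
  go ≤′-refl       = ≤-refl
  go (≤′-step m≤n) = ≤-trans (go m≤n) (step _)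

m<n≤1+o⇒m≤o : ∀ {m n o} → m < n → n ≤ suc o → m ≤ o
m<n≤1+o⇒m≤o m<n n≤1+o = ≤-pred (<-≤-trans m<n n≤1+o)

module Table {Σ : Set} (_≟_ : DecidableEquality Σ) (A B : ℕ → Σ) (k : ℕ) (0<k : 0 < k) where

  Mf : ℕ → ℕ → ℕ → ℕ
  Mf = Mfuel _≟_ A B k

  M′ : ℕ → ℕ → ℕ
  M′ = M _≟_ A B k

  block : ℕ → ℕ → Bool
  block = blockEq _≟_ A B k

  module _ {i j : ℕ} (k≤i : k ≤ i) (k≤j : k ≤ j) where

    up-< : i ∸ 1 + j < i + j
    up-< = +-monoˡ-< j (∸-monoʳ-< (s≤s z≤n) (≤-trans 0<k k≤i))

    left-< : i + (j ∸ 1) < i + j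
    left-< = +-monoʳ-< i (∸-monoʳ-< (s≤s z≤n) (≤-trans 0<k k≤j))

    diag-< : i ∸ k + (j ∸ k) < i + j
    diag-< = ≤-<-trans (+-monoʳ-≤ (i ∸ k) (m∸n≤m j k)) (+-monoˡ-< j (∸-monoʳ-< 0<k k≤i))

  Mfuel-origin : ∀ s → Mf s 0 0 ≡ 0
  Mfuel-origin zero = refl
  Mfuel-origin (suc s) with 0 <? k
  ... | yes _   = refl
  ... | no 0≮k = contradiction 0<k 0≮k

  Mfuel-irrelevant : ∀ s t i j → i + j ≤ s → i + j ≤ t → Mf s i j ≡ Mf t i j
  Mfuel-irrelevant zero    t       zero zero _ _ = sym (Mfuel-origin t)
  Mfuel-irrelevant (suc s) zero    zero zero _ _ = Mfuel-origin (suc s)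
  Mfuel-irrelevant (suc s) (suc t) i j p q with i <? k | j <? k
  ... | yes _ | _     = refl
  ... | no _  | yes _ = refl
  ... | no i≮k | no j≮k with block i j
  ... | true  = cong suc (Mfuel-irrelevant s t _ _ (m<n≤1+o⇒m≤o d p) (m<n≤1+o⇒m≤o d q))
    where d = diag-< (≮⇒≥ i≮k) (≮⇒≥ j≮k)
  ... | false = cong₂ _⊔_ (Mfuel-irrelevant s t _ _ (m<n≤1+o⇒m≤o l p) (m<n≤1+o⇒m≤o l q))
                          (Mfuel-irrelevant s t _ _ (m<n≤1+o⇒m≤o u p) (m<n≤1+o⇒m≤o u q))
    where l = left-< (≮⇒≥ i≮k) (≮⇒≥ j≮k) ; u = up-< (≮⇒≥ i≮k) (≮⇒≥ j≮k)

  M-unfold : ∀ i j → M′ i j ≡ Mf (suc (i + j)) i j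
  M-unfold i j = Mfuel-irrelevant (i + j) (suc (i + j)) i j ≤-refl (n≤1+n _)

  M-row : ∀ {i} j → i < k → M′ i j ≡ 0
  M-row {i} j i<k rewrite M-unfold i j with i <? k
  ... | yes _   = refl
  ... | no i≮k = contradiction i<k i≮k

  M-col : ∀ i {j} → j < k → M′ i j ≡ 0
  M-col i {j} j<k rewrite M-unfold i j with i <? k | j <? k
  ... | yes _ | _       = refl
  ... | no _  | yes _   = refl
  ... | no _  | no j≮k = contradiction j<k j≮k

  M-rec : ∀ {i j} → k ≤ i → k ≤ j →
          M′ i j ≡ (if block i j then suc (M′ (i ∸ k) (j ∸ k)) else M′ i (j ∸ 1) ⊔ M′ (i ∸ 1) j)
  M-rec {i} {j} k≤i k≤j rewrite M-unfold i j with i <? k | j <? k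
  ... | yes i<k | _       = contradiction k≤i (<⇒≱ i<k)
  ... | no _    | yes j<k = contradiction k≤j (<⇒≱ j<k)
  ... | no _    | no _ with block i j
  ... | true  = cong suc (Mfuel-irrelevant _ _ _ _ (<⇒≤ (diag-< k≤i k≤j)) ≤-refl)
  ... | false = cong₂ _⊔_ (Mfuel-irrelevant _ _ _ _ (<⇒≤ (left-< k≤i k≤j)) ≤-refl)
                          (Mfuel-irrelevant _ _ _ _ (<⇒≤ (up-< k≤i k≤j)) ≤-refl)

  M-between : ∀ {i j} → k ≤ i → k ≤ j →
              M′ i (j ∸ 1) ⊔ M′ (i ∸ 1) j ≤ suc (M′ (i ∸ k) (j ∸ k)) →
              M′ i (j ∸ 1) ⊔ M′ (i ∸ 1) j ≤ M′ i j × M′ i j ≤ suc (M′ (i ∸ k) (j ∸ k))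
  M-between {i} {j} k≤i k≤j neighbours≤ rewrite M-rec k≤i k≤j with block i j
  ... | true  = neighbours≤ , ≤-refl
  ... | false = ≤-refl , neighbours≤

  -- The three bounds are proved by one induction on i + j: in the match case,
  -- left≤ and up≤ need diag≤ at the neighbouring cells.
  record LocalBounds (i j : ℕ) : Set where
    field
      left≤ : M′ i (j ∸ 1) ≤ M′ i j
      up≤   : M′ (i ∸ 1) j ≤ M′ i j
      diag≤ : M′ i j ≤ suc (M′ (i ∸ k) (j ∸ k))

  open LocalBounds

  localBounds-vanishing : ∀ {i j} → M′ i (j ∸ 1) ≡ 0 → M′ (i ∸ 1) j ≡ 0 → M′ i j ≡ 0 → LocalBounds i j
  localBounds-vanishing {i} {j} left≡0 up≡0 M≡0 = record
    { left≤ = ≤-reflexive (trans left≡0 (sym M≡0))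
    ; up≤   = ≤-reflexive (trans up≡0 (sym M≡0))
    ; diag≤ = subst (_≤ suc (M′ (i ∸ k) (j ∸ k))) (sym M≡0) z≤n
    }

  localBounds-rec : ∀ {i j} → k ≤ i → k ≤ j →
                    LocalBounds i (j ∸ 1) → LocalBounds (i ∸ 1) j → LocalBounds (i ∸ k) (j ∸ k) →
                    LocalBounds i j
  localBounds-rec {i} {j} k≤i k≤j left up diag = record
    { left≤ = ≤-trans (m≤m⊔n _ _) neighbours≤M
    ; up≤   = ≤-trans (m≤n⊔m _ _) neighbours≤M
    ; diag≤ = M≤diag
    }
    where
    left≤diag : M′ i (j ∸ 1) ≤ suc (M′ (i ∸ k) (j ∸ k))
    left≤diag = ≤-trans (diag≤ left)
      (s≤s (subst (λ x → M′ (i ∸ k) x ≤ M′ (i ∸ k) (j ∸ k)) (∸-∸-comm j k 1) (left≤ diag)))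
    up≤diag : M′ (i ∸ 1) j ≤ suc (M′ (i ∸ k) (j ∸ k))
    up≤diag = ≤-trans (diag≤ up)
      (s≤s (subst (λ x → M′ x (j ∸ k) ≤ M′ (i ∸ k) (j ∸ k)) (∸-∸-comm i k 1) (up≤ diag)))
    neighbours≤M = proj₁ (M-between k≤i k≤j (⊔-lub left≤diag up≤diag))
    M≤diag = proj₂ (M-between k≤i k≤j (⊔-lub left≤diag up≤diag))

  localBounds : ∀ s i j → i + j < s → LocalBounds i j
  localBounds (suc s) i j (s≤s i+j≤s) with i <? k | j <? k
  ... | yes i<k | _ =
    localBounds-vanishing (M-row (j ∸ 1) i<k) (M-row j (≤-<-trans (m∸n≤m i 1) i<k)) (M-row j i<k)
  ... | no _ | yes j<k =
    localBounds-vanishing (M-col i (≤-<-trans (m∸n≤m j 1) j<k)) (M-col (i ∸ 1) j<k) (M-col i j<k)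
  ... | no i≮k | no j≮k =
    localBounds-rec k≤i k≤j (recurse (left-< k≤i k≤j)) (recurse (up-< k≤i k≤j)) (recurse (diag-< k≤i k≤j))
    where
    k≤i = ≮⇒≥ i≮k ; k≤j = ≮⇒≥ j≮k
    recurse : ∀ {i′ j′} → i′ + j′ < i + j → LocalBounds i′ j′
    recurse lt = localBounds s _ _ (<-≤-trans lt i+j≤s)

  localBounds-everywhere : ∀ i j → LocalBounds i j
  localBounds-everywhere i j = localBounds (suc (i + j)) i j ≤-refl

  M-monoʳ : ∀ i {j j′} → j ≤ j′ → M′ i j ≤ M′ i j′
  M-monoʳ i = monotone-from-step (M′ i) (λ j → left≤ (localBounds-everywhere i (suc j)))

  M-monoˡ : ∀ {i i′} j → i ≤ i′ → M′ i j ≤ M′ i′ j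
  M-monoˡ j = monotone-from-step (λ i → M′ i j) (λ i → up≤ (localBounds-everywhere (suc i) j))

  M-window : ∀ {i j i′ j′} → i′ ≤ k + i → j′ ≤ k + j → M′ i′ j′ ≤ suc (M′ i j)
  M-window {i} {j} {i′} {j′} i′≤k+i j′≤k+j = ≤-trans (diag≤ (localBounds-everywhere i′ j′))
    (s≤s (≤-trans (M-monoˡ (j′ ∸ k) (m≤n+o⇒m∸n≤o i′ k i′≤k+i))
                  (M-monoʳ i (m≤n+o⇒m∸n≤o j′ k j′≤k+j))))

lemma2 : {Σ : Set} (_≟_ : DecidableEquality Σ) (k n : ℕ) → 1 ≤ k →
    (A B : ℕ → Σ) → (i h j : ℕ) → i ≤ n →
    InV _≟_ A B n k i h j →
    ¬ (∃[ i' ] ∃[ j' ] (i ≤ i' × i' ≤ i + k × j' < j + k × InV _≟_ A B n k i' (h + 1) j'))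
lemma2 _≟_ k n 0<k A B i h (suc j) _ (_ , _ , _ , M-jump , h≡M)
       (i′ , j′ , _ , i′≤i+k , j′<j+1+k , (_ , _ , _ , _ , h+1≡M′)) = n≮n h h<h
  where
  open Table _≟_ A B k 0<k
  open ≤-Reasoning
  h<h : h < h
  h<h = begin-strict
    h                    <⟨ m<m+n h (s≤s z≤n) ⟩
    h + 1                ≡⟨ h+1≡M′ ⟩
    M′ i′ j′             ≤⟨ M-window (subst (i′ ≤_) (+-comm i k) i′≤i+k)
                                     (subst (j′ ≤_) (+-comm j k) (≤-pred j′<j+1+k)) ⟩
    suc (M′ i j)         ≡⟨ +-comm 1 (M′ i j) ⟩
    M′ i j + 1           ≡⟨ M-jump ⟩
    M′ i (suc j)         ≡⟨ h≡M ⟨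
    h                    ∎
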